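{- Let $\vec S$ be a submodular separation system in a universe $\vec U$, and let $O$ be a strongly consistent orientation of $S$. If every star $\sigma\subseteq O$ is contained in some profile of $S$, then there exists one profile of $S$ that contains all these stars.
   Context: A separation system is a poset $\vec S$ with an order-reversing involution ${}^*$; write $\overleftarrow s:=\vec s^{\,*}$, a separation is $s=\{\vec s,\overleftarrow s\}$, $S$ the set of separations. A universe $\vec U$ is a separation system that is a lattice (join $\vee$, meet $\wedge$). $\vec S\subseteq\vec U$ (closed under ${}^*$) is submodular if for all $\vec r,\vec s\in\vec S$ at least one of $\vec r\wedge\vec s$, $\vec r\vee\vec s$ lies in $\vec S$. A separation $s$ is degenerate if $\vec s=\overleftarrow s$; a star is a set $\sigma$ of nondegenerate oriented separations with $\vec r\le\overleftarrow s$ for all distinct $\vec r,\vec s\in\sigma$. An orientation of $S$ is a set $O\subseteq\vec S$ containing exactly one of $\vec s,\overleftarrow s$ for each $s\in S$; it is consistent if there are no distinct $r,s$ with $\vec r<\vec s$ and $\overleftarrow r,\vec s\in O$; strongly consistent if there are no $\vec r,\vec s\in\vec S$ (with $r=s$ allowed) such that $\vec r<\vec s$ and $\overleftarrow r,\vec s\in O$. A profile of $S$ is a consistent orientation of $S$ containing no set of the form $\{\vec r,\vec s,\overleftarrow r\wedge\overleftarrow s\}$ with $\vec r,\vec s\in\vec U$. -}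

module Defs where

open import Level using (Level; _⊔_; suc)
open import Relation.Binary.Core using (Rel)
open import Relation.Binary.Structures using (IsPartialOrder)
open import Relation.Binary.PropositionalEquality using (_≡_)
open import Relation.Binary.Lattice.Definitions using (Supremum; Infimum)
open import Relation.Unary using (Pred; _⊆_)
open import Relation.Nullary using (¬_)
open import Data.Product using (_×_; Σ)
open import Data.Sum using (_⊎_)
open import Data.Empty using (⊥)

record Universe (a ℓ : Level) : Set (suc (a ⊔ ℓ)) where
  infix  4 _≤_ _<_
  infixr 6 _∨_
  infixr 7 _∧_
  infix  9 _*
  field
    Carrier        : Set a
    _≤_            : Rel Carrier ℓ
    isPartialOrder : IsPartialOrder _≡_ _≤_
    _∨_            : Carrier → Carrier → Carrier
    _∧_            : Carrier → Carrier → Carrier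
    supremum       : Supremum _≤_ _∨_
    infimum        : Infimum _≤_ _∧_
    _*             : Carrier → Carrier
    involutive     : ∀ x → (x *) * ≡ x
    order-reversing : ∀ {x y} → x ≤ y → y * ≤ x *

  _<_ : Rel Carrier (a ⊔ ℓ)
  x < y = x ≤ y × ¬ (x ≡ y)

module _ {a ℓ : Level} (U : Universe a ℓ) where
  open Universe U

  -- A separation system inside U: a set of oriented separations closed under *.
  ClosedUnder* : Pred Carrier a → Set a
  ClosedUnder* S = ∀ {x} → S x → S (x *)

  Submodular : Pred Carrier a → Set a
  Submodular S = ∀ {r s} → S r → S s → S (r ∧ s) ⊎ S (r ∨ s)

  Degenerate : Carrier → Set a
  Degenerate x = x ≡ x *

  IsStar : Pred Carrier a → Set (a ⊔ ℓ)
  IsStar σ = (∀ {x} → σ x → ¬ Degenerate x)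
           × (∀ {r s} → σ r → σ s → ¬ (r ≡ s) → r ≤ s *)

  -- O is an orientation of S (the separations with an orientation in S):
  -- O ⊆ S and O contains exactly one of x, x* for every x ∈ S
  -- (when x = x* this just means x ∈ O).
  IsOrientation : Pred Carrier a → Pred Carrier a → Set a
  IsOrientation S O = (O ⊆ S)
                    × (∀ {x} → S x → O x ⊎ O (x *))
                    × (∀ {x} → O x → O (x *) → x ≡ x *)

  -- Consistent: no distinct separations r, s (i.e. r ≠ s and r ≠ s*)
  -- with r < s, r* ∈ O and s ∈ O.
  IsConsistent : Pred Carrier a → Pred Carrier a → Set (a ⊔ ℓ)
  IsConsistent S O = ∀ {r s} → S r → S s → r < s → ¬ (r ≡ s *) →
                     O (r *) → O s → ⊥

  IsStronglyConsistent : Pred Carrier a → Pred Carrier a → Set (a ⊔ ℓ)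
  IsStronglyConsistent S O = ∀ {r s} → S r → S s → r < s → O (r *) → O s → ⊥

  IsProfile : Pred Carrier a → Pred Carrier a → Set (a ⊔ ℓ)
  IsProfile S P = IsOrientation S P × IsConsistent S P
                × (∀ r s → P r → P s → P ((r *) ∧ (s *)) → ⊥)

-- Under these hypotheses O is itself a profile, so it contains every star it contains.
-- O is consistent because it is strongly consistent. If it contained r, s and t = r* ∧ s*,
-- submodularity puts r ∧ s* or (symmetrically) s ∧ r* into S, say r ∧ s*. Being below r,
-- it lies in the strongly consistent O, and {r ∧ s*, s, t} ⊆ O is a star. A profile P
-- containing this star contains r or r*; either way P contains a forbidden triple,
-- {r, s, r* ∧ s*} or {r*, s, r ∧ s*}. Nondegeneracy of S, needed when r ∧ s* = r, holds
-- because the empty star extends to some profile.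
module Submission where

open import Defs
open import Level using (Level)
open import Relation.Unary using (Pred; _⊆_; ｛_｝; _∪_)
open import Data.Product using (Σ; _×_; _,_; proj₁; proj₂)
open import Data.Sum using (inj₁; inj₂)
open import Data.Empty using (⊥; ⊥-elim)
import Data.Empty.Polymorphic as Poly
open import Relation.Binary.PropositionalEquality using (_≡_; refl; sym; trans; subst; cong; module ≡-Reasoning)
open import Relation.Binary.Lattice using (Lattice)
import Relation.Binary.Lattice.Properties.MeetSemilattice as MeetSemilatticeProperties
open import Relation.Nullary using (¬_)

module UniverseProperties {a ℓ : Level} (U : Universe a ℓ) where
  open Universe U

  lattice : Lattice a a ℓ
  lattice = record
    { isLattice = record
      { isPartialOrder = isPartialOrder ; supremum = supremum ; infimum = infimum } }

  open Lattice lattice public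
    renaming (trans to ≤-trans)
    using (antisym; x∧y≤x; x∧y≤y; ∧-greatest; x≤x∨y; y≤x∨y; ∨-least)
  open MeetSemilatticeProperties (Lattice.meetSemilattice lattice) public
    using (∧-comm; ∧-idempotent)

  ≤*⇒≥* : ∀ {x y} → x ≤ y * → y ≤ x *
  ≤*⇒≥* {x} {y} x≤y* = subst (_≤ x *) (involutive y) (order-reversing x≤y*)

  *-∨ : ∀ x y → (x ∨ y) * ≡ x * ∧ y *
  *-∨ x y = antisym
    (∧-greatest (order-reversing (x≤x∨y x y)) (order-reversing (y≤x∨y x y)))
    (≤*⇒≥* (∨-least (≤*⇒≥* (x∧y≤x (x *) (y *))) (≤*⇒≥* (x∧y≤y (x *) (y *)))))

  *-∨-* : ∀ x y → (x ∨ y *) * ≡ y ∧ x *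
  *-∨-* x y = begin
    (x ∨ y *) *   ≡⟨ *-∨ x (y *) ⟩
    x * ∧ y * *   ≡⟨ cong (x * ∧_) (involutive y) ⟩
    x * ∧ y       ≡⟨ ∧-comm (x *) y ⟩
    y ∧ x *       ∎
    where open ≡-Reasoning

module _ {a ℓ : Level} (U : Universe a ℓ) where
  open Universe U
  open UniverseProperties U

  triple : Carrier → Carrier → Carrier → Pred Carrier a
  triple x y z = ｛ x ｝ ∪ ｛ y ｝ ∪ ｛ z ｝

  triple-isStar : ∀ {x y z} → ¬ Degenerate U x → ¬ Degenerate U y → ¬ Degenerate U z →
                  x ≤ y * → x ≤ z * → y ≤ z * → IsStar U (triple x y z)
  triple-isStar {x} {y} {z} x≢x* y≢y* z≢z* x≤y* x≤z* y≤z* = nondegenerate , pointing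
    where
    nondegenerate : ∀ {w} → triple x y z w → ¬ Degenerate U w
    nondegenerate (inj₁ refl)        = x≢x*
    nondegenerate (inj₂ (inj₁ refl)) = y≢y*
    nondegenerate (inj₂ (inj₂ refl)) = z≢z*

    pointing : ∀ {v w} → triple x y z v → triple x y z w → ¬ (v ≡ w) → v ≤ w *
    pointing (inj₁ refl)        (inj₂ (inj₁ refl)) _ = x≤y*
    pointing (inj₁ refl)        (inj₂ (inj₂ refl)) _ = x≤z*
    pointing (inj₂ (inj₁ refl)) (inj₁ refl)        _ = ≤*⇒≥* x≤y*
    pointing (inj₂ (inj₁ refl)) (inj₂ (inj₂ refl)) _ = y≤z*
    pointing (inj₂ (inj₂ refl)) (inj₁ refl)        _ = ≤*⇒≥* x≤z*
    pointing (inj₂ (inj₂ refl)) (inj₂ (inj₁ refl)) _ = ≤*⇒≥* y≤z*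
    pointing (inj₁ refl)        (inj₁ refl)        v≢w = ⊥-elim (v≢w refl)
    pointing (inj₂ (inj₁ refl)) (inj₂ (inj₁ refl)) v≢w = ⊥-elim (v≢w refl)
    pointing (inj₂ (inj₂ refl)) (inj₂ (inj₂ refl)) v≢w = ⊥-elim (v≢w refl)

  module _ {S P : Pred Carrier a} (profile : IsProfile U S P) where
    profile-nondegenerate : ∀ {x} → P x → ¬ Degenerate U x
    profile-nondegenerate {x} px x≡x* =
      proj₂ (proj₂ profile) x x px px (subst P (trans x≡x* (sym (∧-idempotent (x *)))) px)

    profile⇒S-nondegenerate : ∀ {x} → S x → ¬ Degenerate U x
    profile⇒S-nondegenerate {x} sx x≡x* with proj₁ (proj₂ (proj₁ profile)) sx
    ... | inj₁ px  = profile-nondegenerate px x≡x*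
    ... | inj₂ px* = profile-nondegenerate (subst P (sym x≡x*) px*) x≡x*

    profile-excludes-meet-triple : ∀ {r s} → S r → P (r ∧ s *) → P s → P (r * ∧ s *) → ⊥
    profile-excludes-meet-triple {r} {s} sr pr∧s* ps pr*∧s* with proj₁ (proj₂ (proj₁ profile)) sr
    ... | inj₁ pr  = proj₂ (proj₂ profile) r s pr ps pr*∧s*
    ... | inj₂ pr* = proj₂ (proj₂ profile) (r *) s pr* ps
                       (subst (λ z → P (z ∧ s *)) (sym (involutive r)) pr∧s*)

  strongly-consistent-downward-closed :
    ∀ {S O} → IsOrientation U S O → IsStronglyConsistent U S O →
    ∀ {r x} → O r → ¬ Degenerate U r → S x → x ≤ r → O x
  strongly-consistent-downward-closed {S} {O} orientation strong {r} {x} or r≢r* sx x≤r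
    with proj₁ (proj₂ orientation) sx
  ... | inj₁ ox  = ox
  ... | inj₂ ox* = ⊥-elim (strong sx (proj₁ orientation or) (x≤r , x≢r) ox* or)
    where
    x≢r : ¬ (x ≡ r)
    x≢r refl = r≢r* (proj₂ (proj₂ orientation) or ox*)

  module _ {S O : Pred Carrier a}
           (closed : ClosedUnder* U S) (submodular : Submodular U S)
           (orientation : IsOrientation U S O) (strong : IsStronglyConsistent U S O)
           (extend : (σ : Pred Carrier a) → σ ⊆ O → IsStar U σ →
                     Σ (Pred Carrier a) (λ P → IsProfile U S P × σ ⊆ P)) where

    S-nondegenerate : ∀ {x} → S x → ¬ Degenerate U x
    S-nondegenerate with extend (λ _ → Poly.⊥) (λ ()) ((λ ()) , (λ ()))
    ... | _ , profile , _ = profile⇒S-nondegenerate profile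

    O-nondegenerate : ∀ {x} → O x → ¬ Degenerate U x
    O-nondegenerate ox = S-nondegenerate (proj₁ orientation ox)

    no-forbidden-triple-if-meet-in-S : ∀ {r s} → O r → O s → O (r * ∧ s *) → S (r ∧ s *) → ⊥
    no-forbidden-triple-if-meet-in-S {r} {s} or os ot sr∧s* =
      let _ , profile , σ⊆P = extend (triple (r ∧ s *) s (r * ∧ s *)) σ⊆O σ-isStar
      in profile-excludes-meet-triple profile (proj₁ orientation or)
           (σ⊆P (inj₁ refl)) (σ⊆P (inj₂ (inj₁ refl))) (σ⊆P (inj₂ (inj₂ refl)))
      where
      or∧s* : O (r ∧ s *)
      or∧s* = strongly-consistent-downward-closed orientation strong or (O-nondegenerate or)
                sr∧s* (x∧y≤x r (s *))

      σ⊆O : triple (r ∧ s *) s (r * ∧ s *) ⊆ O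
      σ⊆O (inj₁ refl)        = or∧s*
      σ⊆O (inj₂ (inj₁ refl)) = os
      σ⊆O (inj₂ (inj₂ refl)) = ot

      σ-isStar : IsStar U (triple (r ∧ s *) s (r * ∧ s *))
      σ-isStar = triple-isStar (O-nondegenerate or∧s*) (O-nondegenerate os) (O-nondegenerate ot)
        (x∧y≤y r (s *))
        (≤-trans (x∧y≤x r (s *)) (≤*⇒≥* (x∧y≤x (r *) (s *))))
        (≤*⇒≥* (x∧y≤y (r *) (s *)))

    O-isProfile : IsProfile U S O
    O-isProfile = orientation , (λ sr ss r<s _ → strong sr ss r<s) , no-forbidden-triple
      where
      no-forbidden-triple : ∀ r s → O r → O s → O (r * ∧ s *) → ⊥
      no-forbidden-triple r s or os ot with submodular (proj₁ orientation or) (closed (proj₁ orientation os))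
      ... | inj₁ sr∧s* = no-forbidden-triple-if-meet-in-S or os ot sr∧s*
      ... | inj₂ sr∨s* = no-forbidden-triple-if-meet-in-S os or (subst O (∧-comm (r *) (s *)) ot)
                           (subst S (*-∨-* r s) (closed sr∨s*))

corollary3p6 : {a ℓ : Level} (U : Universe a ℓ) (S O : Pred (Universe.Carrier U) a) →
    ClosedUnder* U S → Submodular U S →
    IsOrientation U S O → IsStronglyConsistent U S O →
    ((σ : Pred (Universe.Carrier U) a) → σ ⊆ O → IsStar U σ →
      Σ (Pred (Universe.Carrier U) a) (λ P → IsProfile U S P × σ ⊆ P)) →
    Σ (Pred (Universe.Carrier U) a)
      (λ P → IsProfile U S P ×
        ((σ : Pred (Universe.Carrier U) a) → σ ⊆ O → IsStar U σ → σ ⊆ P))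
corollary3p6 U S O closed submodular orientation strong extend =
  O , O-isProfile U closed submodular orientation strong extend , λ σ σ⊆O _ → σ⊆O
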